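{- Let $p$ be an odd prime of the form $p=2^n d+1$ with $d$ odd and $n \geq 1$. Then for all integers $a,b$, \[ K(a,b,p,\tfrac{p-1}{2^{n-1}})=2\operatorname{Re} K(a,b,p,\tfrac{p-1}{2^n}). \]
   Context: Let $e(x)=\exp(2\pi i x)$. For a prime $p$ and a positive divisor $k$ of $p-1$, define $K(a,b,p,k)=\sum_{u\in(\mathbb{Z}/p\mathbb{Z})^\times,\ u^k=1} e\big(\frac{au+bu^{ -1}}{p}\big)$, where $u^{ -1}$ is the inverse of $u$ modulo $p$. -}

module Defs where

open import Data.Nat as ℕ using (ℕ; zero; suc; _∸_; _^_; _<_; _≤?_; _≟_)
open import Data.Nat.Properties using (m^n≢0)
open import Data.Integer as ℤ using (ℤ; +_; _%ℕ_)
open import Data.List using (List; upTo; map)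
open import Data.Nat.ListAction using (sum)
open import Data.Product using (∃)
open import Data.Bool using (if_then_else_)
open import Relation.Nullary.Decidable using (⌊_⌋; _×-dec_)
open import Relation.Binary.PropositionalEquality using (_≡_)

-- Reduction of an integer modulo p, as a natural number in [0, p).
-- (Only used for p ≥ 2; the p = 0 case is a dummy.)
modℤ : ℕ → ℤ → ℕ
modℤ zero    x = 0
modℤ (suc q) x = x %ℕ suc q

modℕ : ℕ → ℕ → ℕ
modℕ zero    x = 0
modℕ (suc q) x = x ℕ.% suc q

-- m / 2^e  (integer division; exact in the use below)
_/2^_ : ℕ → ℕ → ℕ
m /2^ e = ℕ._/_ m (2 ^ e) {{m^n≢0 2 e}}

-- An element of ℤ[ζ_p] ⊂ ℂ, ζ_p = e(1/p), written as Σ_{j<p} f(j) ζ_p^j.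
-- Only the coefficients at j < p matter.
Cyc : Set
Cyc = ℕ → ℤ

-- Equality of the complex numbers Σ_{j<p} f(j) ζ^j and Σ_{j<p} g(j) ζ^j:
-- since the only Q-linear relation among 1, ζ, …, ζ^{p-1} (p prime) is
-- 1 + ζ + … + ζ^{p-1} = 0, this holds iff f - g is constant on [0,p).
_≈[_]_ : Cyc → ℕ → Cyc → Set
f ≈[ p ] g = ∃ λ (c : ℤ) → ∀ j → j < p → f j ≡ g j ℤ.+ c

_⊕_ : Cyc → Cyc → Cyc
(f ⊕ g) j = f j ℤ.+ g j

-- complex conjugation: ζ^j ↦ ζ^{-j}
conj : ℕ → Cyc → Cyc
conj p f j = f (modℕ p (p ∸ j))

𝟙 : Data.Bool.Bool → ℕ
𝟙 b = if b then 1 else 0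

-- K(a,b,p,k) = Σ_{u ∈ (Z/p)^×, u^k = 1} e((a u + b u⁻¹)/p).
-- Coefficient of ζ^j: the number of u ∈ {1,…,p-1} with u^k ≡ 1 (mod p)
-- and a u + b u⁻¹ ≡ j (mod p); u⁻¹ is the (unique, for p prime)
-- v ∈ {0,…,p-1} with u v ≡ 1 (mod p), so we count such pairs (u , v).
K : ℤ → ℤ → ℕ → ℕ → Cyc
K a b p k j = + sum (map (λ u → sum (map (λ v →
    𝟙 ⌊ (1 ≤? u) ×-dec
       ((modℕ p (u ℕ.* v) ≟ 1) ×-dec
       ((modℕ p (u ^ k) ≟ 1) ×-dec
        (modℤ p (a ℤ.* + u ℤ.+ b ℤ.* + v) ≟ j))) ⌋)
    (upTo p))) (upTo p))

module Submission where

-- The exponents are d = (p-1)/2^n, which is odd, and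
-- (p-1)/2^(n-1) = 2d.  For a unit u mod p we have u^(2d) = 1 iff
-- u^d = ±1 (the only square roots of 1 modulo a prime are ±1), and since
-- d is odd, u^d = -1 iff (-u)^d = 1; the two cases are exclusive as p > 2.
-- The substitution (u, u⁻¹) ↦ (-u, -u⁻¹) sends a u + b u⁻¹ to its negative,
-- so the pairs with (-u)^d = 1 contributing to ζ^j are exactly the negatives
-- of the pairs with u^d = 1 contributing to ζ^(-j).  Coefficientwise this
-- gives K(a,b,p,2d) = K(a,b,p,d) + conj K(a,b,p,d) exactly, i.e. the
-- identity 2 Re K.  In fact this holds for every odd d, not only d | p-1.

open import Defs
open import Data.Nat using (ℕ; zero; suc; _+_; _*_; _^_; _∸_; _≤_; _<_; z≤n; s≤s)
open import Data.Nat.Primality using (Prime; euclidsLemma; ¬prime[0]; ¬prime[1])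
open import Data.Integer using (ℤ; +_; -_; _-_)
open import Relation.Nullary using (¬_; Dec; yes; no)
open import Relation.Nullary.Decidable using (⌊_⌋; _×-dec_)
open import Data.Nat.Divisibility using (_∣_; divides; ∣-refl; ∣⇒≤)
open import Relation.Binary.PropositionalEquality
  using (_≡_; refl; sym; trans; cong; cong₂; subst; subst₂; module ≡-Reasoning)

import Data.Nat as ℕ
import Data.Nat.Properties as ℕP
import Data.Nat.DivMod as ℕD
import Data.Integer as ℤ
import Data.Integer.Properties as ℤP
import Data.Integer.DivMod as ℤD
import Data.Integer.Divisibility.Signed as ℤS
open import Data.Integer.Tactic.RingSolver using (solve-∀)
import Data.Nat.Tactic.RingSolver as ℕR
open import Data.List using (map; applyUpTo)
open import Data.Nat.ListAction using (sum)
open import Data.Product using (_×_; _,_; ∃)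
open import Data.Sum using (_⊎_; inj₁; inj₂; [_,_]′)
open import Data.Empty using (⊥-elim)
open import Function using (_∘_; _⇔_; mk⇔; Equivalence)
open import Level using (0ℓ)
open import Relation.Binary.Bundles using (Setoid)
import Relation.Binary.Reasoning.Setoid as SetoidReasoning

open Equivalence using (to; from)

∑ : ℕ → (ℕ → ℕ) → ℕ
∑ zero    f = 0
∑ (suc m) f = f 0 + ∑ m (f ∘ suc)

sum-applyUpTo : ∀ m (g f : ℕ → ℕ) → sum (map f (applyUpTo g m)) ≡ ∑ m (f ∘ g)
sum-applyUpTo zero    g f = refl
sum-applyUpTo (suc m) g f = cong (_+_ (f (g 0))) (sum-applyUpTo m (g ∘ suc) f)

∑-cong : ∀ m {f g : ℕ → ℕ} → (∀ x → x < m → f x ≡ g x) → ∑ m f ≡ ∑ m g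
∑-cong zero    eq = refl
∑-cong (suc m) eq = cong₂ _+_ (eq 0 (s≤s z≤n)) (∑-cong m (λ x x<m → eq (suc x) (s≤s x<m)))

∑-+ : ∀ m (f g : ℕ → ℕ) → ∑ m (λ x → f x + g x) ≡ ∑ m f + ∑ m g
∑-+ zero    f g = refl
∑-+ (suc m) f g = trans (cong (_+_ (f 0 + g 0)) (∑-+ m (f ∘ suc) (g ∘ suc)))
                        (interchange (f 0) (g 0) _ _)
  where
  interchange : ∀ a b c d → (a + b) + (c + d) ≡ (a + c) + (b + d)
  interchange = ℕR.solve-∀

∑-snoc : ∀ m f → ∑ (suc m) f ≡ ∑ m f + f m
∑-snoc zero    f = ℕP.+-identityʳ (f 0)
∑-snoc (suc m) f = trans (cong (_+_ (f 0)) (∑-snoc m (f ∘ suc))) (sym (ℕP.+-assoc (f 0) _ _))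

∑-reverse : ∀ m f → ∑ m f ≡ ∑ m (λ x → f (m ∸ suc x))
∑-reverse zero    f = refl
∑-reverse (suc m) f = begin
    f 0 + ∑ m (f ∘ suc)
  ≡⟨ cong (_+_ (f 0)) (trans (∑-reverse m (f ∘ suc))
       (∑-cong m (λ x x<m → cong f (sym (ℕP.+-∸-assoc 1 x<m))))) ⟩
    f 0 + ∑ m (λ x → f (m ∸ x))
  ≡⟨ ℕP.+-comm (f 0) _ ⟩
    ∑ m (λ x → f (m ∸ x)) + f 0
  ≡⟨ cong (λ t → ∑ m (λ x → f (m ∸ x)) + f t) (sym (ℕP.n∸n≡0 m)) ⟩
    ∑ m (λ x → f (m ∸ x)) + f (m ∸ m)
  ≡⟨ sym (∑-snoc m (λ x → f (m ∸ x))) ⟩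
    ∑ (suc m) (λ x → f (suc m ∸ suc x))
  ∎
  where open ≡-Reasoning

𝟙-split : ∀ {X Y Z : Set} (X? : Dec X) (Y? : Dec Y) (Z? : Dec Z) →
  (X → Y ⊎ Z) → (Y ⊎ Z → X) → (Y → ¬ Z) →
  𝟙 ⌊ X? ⌋ ≡ 𝟙 ⌊ Y? ⌋ + 𝟙 ⌊ Z? ⌋
𝟙-split (yes x) (yes y) (yes z) _ _ excl = ⊥-elim (excl y z)
𝟙-split (yes x) (yes y) (no ¬z) _ _ _    = refl
𝟙-split (yes x) (no ¬y) (yes z) _ _ _    = refl
𝟙-split (yes x) (no ¬y) (no ¬z) split _ _ = ⊥-elim ([ ¬y , ¬z ]′ (split x))
𝟙-split (no ¬x) (yes y) _       _ join _ = ⊥-elim (¬x (join (inj₁ y)))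
𝟙-split (no ¬x) (no ¬y) (yes z) _ join _ = ⊥-elim (¬x (join (inj₂ z)))
𝟙-split (no ¬x) (no ¬y) (no ¬z) _ _ _    = refl

neg-^-odd : ∀ x m → (- x) ℤ.^ suc (m * 2) ≡ - (x ℤ.^ suc (m * 2))
neg-^-odd x zero    = negate-one x
  where
  negate-one : ∀ x → (- x) ℤ.* ℤ.1ℤ ≡ - (x ℤ.* ℤ.1ℤ)
  negate-one = solve-∀
neg-^-odd x (suc m) = trans (cong (λ t → (- x) ℤ.* ((- x) ℤ.* t)) (neg-^-odd x m))
                            (negate-three x (x ℤ.^ suc (m * 2)))
  where
  negate-three : ∀ x y → (- x) ℤ.* ((- x) ℤ.* (- y)) ≡ - (x ℤ.* (x ℤ.* y))
  negate-three = solve-∀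

pos-^ : ∀ u k → + (u ^ k) ≡ (+ u) ℤ.^ k
pos-^ u zero    = refl
pos-^ u (suc k) = trans (ℤP.pos-* u (u ^ k)) (cong (ℤ._*_ (+ u)) (pos-^ u k))

module Mod (q : ℕ) where

  p : ℕ
  p = suc q

  P : ℤ
  P = + p

  infix 4 _~_
  record _~_ (x y : ℤ) : Set where
    constructor mk
    field divides-difference : P ℤS.∣ (x - y)
  open _~_

  private
    via : ∀ {x y e} → x - y ≡ e → P ℤS.∣ e → x ~ y
    via eq d = mk (subst (P ℤS.∣_) (sym eq) d)

  ~-refl : ∀ {x} → x ~ x
  ~-refl {x} = mk (ℤS.divides ℤ.0ℤ (trans (ℤP.+-inverseʳ x) (sym (ℤP.*-zeroˡ P))))

  ~-reflexive : ∀ {x y} → x ≡ y → x ~ y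
  ~-reflexive refl = ~-refl

  ~-sym : ∀ {x y} → x ~ y → y ~ x
  ~-sym {x} {y} h = via (flip x y) (ℤS.∣m⇒∣-m (divides-difference h))
    where
    flip : ∀ x y → y - x ≡ - (x - y)
    flip = solve-∀

  ~-trans : ∀ {x y z} → x ~ y → y ~ z → x ~ z
  ~-trans {x} {y} {z} h k = via (telescope x y z)
    (ℤS.∣m∣n⇒∣m+n (divides-difference h) (divides-difference k))
    where
    telescope : ∀ x y z → x - z ≡ (x - y) ℤ.+ (y - z)
    telescope = solve-∀

  ~-+ : ∀ {x y z w} → x ~ y → z ~ w → x ℤ.+ z ~ y ℤ.+ w
  ~-+ {x} {y} {z} {w} h k = via (regroup x y z w)
    (ℤS.∣m∣n⇒∣m+n (divides-difference h) (divides-difference k))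
    where
    regroup : ∀ x y z w → (x ℤ.+ z) - (y ℤ.+ w) ≡ (x - y) ℤ.+ (z - w)
    regroup = solve-∀

  ~-* : ∀ {x y z w} → x ~ y → z ~ w → x ℤ.* z ~ y ℤ.* w
  ~-* {x} {y} {z} {w} h k = via (regroup x y z w)
    (ℤS.∣m∣n⇒∣m+n (ℤS.∣m⇒∣m*n z (divides-difference h)) (ℤS.∣n⇒∣m*n y (divides-difference k)))
    where
    regroup : ∀ x y z w → (x ℤ.* z) - (y ℤ.* w) ≡ (x - y) ℤ.* z ℤ.+ y ℤ.* (z - w)
    regroup = solve-∀

  ~-^ : ∀ {x y} k → x ~ y → x ℤ.^ k ~ y ℤ.^ k
  ~-^ zero    h = ~-refl
  ~-^ (suc k) h = ~-* h (~-^ k h)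

  ~-neg : ∀ {x y} → x ~ y → - x ~ - y
  ~-neg {x} {y} h = via (negate x y) (ℤS.∣m⇒∣-m (divides-difference h))
    where
    negate : ∀ x y → (- x) - (- y) ≡ - (x - y)
    negate = solve-∀

  ~-neg⁻¹ : ∀ {x y} → - x ~ - y → x ~ y
  ~-neg⁻¹ {x} {y} h = subst₂ _~_ (ℤP.neg-involutive x) (ℤP.neg-involutive y) (~-neg h)

  ~-setoid : Setoid 0ℓ 0ℓ
  ~-setoid = record
    { Carrier = ℤ ; _≈_ = _~_
    ; isEquivalence = record { refl = ~-refl ; sym = ~-sym ; trans = ~-trans } }

  module ~-Reasoning = SetoidReasoning ~-setoid

  P~0 : P ~ ℤ.0ℤ
  P~0 = mk (ℤS.divides (+ 1) (trans (ℤP.+-identityʳ P) (sym (ℤP.*-identityˡ P))))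

  modℕ-~ : ∀ y → + (modℕ p y) ~ + y
  modℕ-~ y = via {e = (- + (y ℕD./ p)) ℤ.* P}
    (trans (cong (_-_ (+ r)) split) (cancel (+ r) (+ (y ℕD./ p)) P))
    (ℤS.∣n⇒∣m*n (- + (y ℕD./ p)) ℤS.∣-refl)
    where
    r = y ℕD.% p
    split : + y ≡ + r ℤ.+ + (y ℕD./ p) ℤ.* P
    split = trans (cong +_ (ℕD.m≡m%n+[m/n]*n y p))
      (trans (ℤP.pos-+ r _) (cong (ℤ._+_ (+ r)) (ℤP.pos-* (y ℕD./ p) p)))
    cancel : ∀ r k P → r - (r ℤ.+ k ℤ.* P) ≡ (- k) ℤ.* P
    cancel = solve-∀

  modℤ-~ : ∀ z → + (modℤ p z) ~ z
  modℤ-~ z = via {e = (- (z ℤD./ℕ p)) ℤ.* P}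
    (trans (cong (_-_ (+ (modℤ p z))) (ℤD.a≡a%ℕn+[a/ℕn]*n z p))
      (cancel (+ (modℤ p z)) (z ℤD./ℕ p) P))
    (ℤS.∣n⇒∣m*n (- (z ℤD./ℕ p)) ℤS.∣-refl)
    where
    cancel : ∀ r k P → r - (r ℤ.+ k ℤ.* P) ≡ (- k) ℤ.* P
    cancel = solve-∀

  multiple-below-p : ∀ x → p ∣ x → x < p → x ≡ 0
  multiple-below-p zero    _   _   = refl
  multiple-below-p (suc x) p∣x x<p = ⊥-elim (ℕP.<-irrefl refl (ℕP.<-≤-trans x<p (∣⇒≤ p∣x)))

  residue-unique-≤ : ∀ {r w} → r ≤ w → w < p → + r ~ + w → r ≡ w
  residue-unique-≤ {r} {w} r≤w w<p h =
    ℕP.≤-antisym r≤w (ℕP.m∸n≡0⇒m≤n (multiple-below-p (w ∸ r) p∣w∸r w∸r<p))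
    where
    p∣w∸r : p ∣ (w ∸ r)
    p∣w∸r = ℤS.∣⇒∣ᵤ (subst (P ℤS.∣_) (trans (ℤP.m-n≡m⊖n w r) (ℤP.⊖-≥ r≤w))
                                       (divides-difference (~-sym h)))
    w∸r<p : w ∸ r < p
    w∸r<p = ℕP.≤-<-trans (ℕP.m∸n≤m w r) w<p

  residue-unique : ∀ {r w} → r < p → w < p → + r ~ + w → r ≡ w
  residue-unique {r} {w} r<p w<p h with ℕP.≤-total r w
  ... | inj₁ r≤w = residue-unique-≤ r≤w w<p h
  ... | inj₂ w≤r = sym (residue-unique-≤ w≤r r<p (~-sym h))

  modℤ≡⇔~ : ∀ z w → w < p → (modℤ p z ≡ w) ⇔ (z ~ + w)
  modℤ≡⇔~ z w w<p = mk⇔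
    (λ { refl → ~-sym (modℤ-~ z) })
    (λ h → residue-unique (ℤD.n%ℕd<d z p) w<p (~-trans (modℤ-~ z) h))

  neg : ℕ → ℕ
  neg x = modℕ p (p ∸ x)

  neg-~ : ∀ {x} → x ≤ p → + (neg x) ~ - + x
  neg-~ {x} x≤p = begin
      + (neg x)          ≈⟨ modℕ-~ (p ∸ x) ⟩
      + (p ∸ x)          ≡⟨ trans (sym (ℤP.⊖-≥ x≤p)) (sym (ℤP.m-n≡m⊖n p x)) ⟩
      P ℤ.+ - + x        ≈⟨ ~-+ P~0 (~-refl {x = - + x}) ⟩
      ℤ.0ℤ ℤ.+ - + x     ≡⟨ ℤP.+-identityˡ (- + x) ⟩
      - + x              ∎
    where open ~-Reasoning

  neg<p : ∀ x → neg x < p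
  neg<p x = ℕD.m%n<n (p ∸ x) p

  neg-nonzero : ∀ {x} → 1 ≤ x → x < p → 1 ≤ neg x
  neg-nonzero {suc u} _ (s≤s u<q) =
    subst (1 ≤_) (sym (ℕD.m<n⇒m%n≡m (s≤s (ℕP.m∸n≤m q u)))) (ℕP.m<n⇒0<n∸m u<q)

  neg-nonzero⁻¹ : ∀ x → 1 ≤ neg x → 1 ≤ x
  neg-nonzero⁻¹ zero    h = ⊥-elim (ℕP.<-irrefl (sym (ℕD.n%n≡0 p)) h)
  neg-nonzero⁻¹ (suc x) h = s≤s z≤n

  neg-^-odd-~ : ∀ {u} m → u ≤ p → + (neg u ^ suc (m * 2)) ~ - + (u ^ suc (m * 2))
  neg-^-odd-~ {u} m u≤p = begin
      + (neg u ^ k)        ≡⟨ pos-^ (neg u) k ⟩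
      (+ neg u) ℤ.^ k      ≈⟨ ~-^ k (neg-~ u≤p) ⟩
      (- + u) ℤ.^ k        ≡⟨ neg-^-odd (+ u) m ⟩
      - ((+ u) ℤ.^ k)      ≡⟨ cong -_ (sym (pos-^ u k)) ⟩
      - + (u ^ k)          ∎
    where
    k = suc (m * 2)
    open ~-Reasoning

  ∑-neg : ∀ f → ∑ p f ≡ ∑ p (f ∘ neg)
  ∑-neg f = cong₂ _+_ (cong f (sym (ℕD.n%n≡0 p)))
    (trans (∑-reverse q (f ∘ suc))
      (∑-cong q (λ x x<q → cong f (trans (sym (ℕP.+-∸-assoc 1 x<q))
         (sym (ℕD.m<n⇒m%n≡m (s≤s (ℕP.m∸n≤m q x))))))))

  sqrt-one : Prime p → ∀ x → x ℤ.* x ~ + 1 → x ~ + 1 ⊎ x ~ - + 1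
  sqrt-one p-prime x h with euclidsLemma _ _ p-prime p∣product
    where
    factor : ∀ x → x ℤ.* x - + 1 ≡ (x - + 1) ℤ.* (x - - + 1)
    factor = solve-∀
    p∣product : p ∣ ℤ.∣ x - + 1 ∣ * ℤ.∣ x - - + 1 ∣
    p∣product = subst (p ∣_) (ℤP.abs-* (x - + 1) (x - - + 1))
      (ℤS.∣⇒∣ᵤ (subst (P ℤS.∣_) (factor x) (divides-difference h)))
  ... | inj₁ p∣x-1 = inj₁ (mk (ℤS.∣ᵤ⇒∣ p∣x-1))
  ... | inj₂ p∣x+1 = inj₂ (mk (ℤS.∣ᵤ⇒∣ p∣x+1))

  one≁minus-one : 2 ≤ q → ¬ (+ 1 ~ - + 1)
  one≁minus-one 2≤q h = ℕP.<-irrefl refl (ℕP.≤-trans (∣⇒≤ (ℤS.∣⇒∣ᵤ (divides-difference h))) 2≤q)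

module Doubling (q : ℕ) (2≤q : 2 ≤ q) (p-prime : Prime (suc q)) (a b : ℤ) (m : ℕ) where
  open Mod q

  d : ℕ
  d = suc (m * 2)

  1<p : 1 < p
  1<p = s≤s (ℕP.≤-trans (s≤s z≤n) 2≤q)

  isOne⇔ : ∀ x → (modℕ p x ≡ 1) ⇔ (+ x ~ + 1)
  isOne⇔ x = modℤ≡⇔~ (+ x) 1 1<p

  Counted : ℕ → ℕ → ℕ → ℕ → Set
  Counted k j u v = 1 ≤ u × (modℕ p (u * v) ≡ 1 × (modℕ p (u ^ k) ≡ 1 ×
                    modℤ p (a ℤ.* + u ℤ.+ b ℤ.* + v) ≡ j))

  counted? : ∀ k j u v → Dec (Counted k j u v)
  counted? k j u v = (1 ℕ.≤? u) ×-dec ((modℕ p (u * v) ℕ.≟ 1) ×-dec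
    ((modℕ p (u ^ k) ℕ.≟ 1) ×-dec (modℤ p (a ℤ.* + u ℤ.+ b ℤ.* + v) ℕ.≟ j)))

  count : ℕ → ℕ → ℕ → ℕ → ℕ
  count k j u v = 𝟙 ⌊ counted? k j u v ⌋

  inverse-neg : ∀ {u v} → u ≤ p → v ≤ p → (modℕ p (u * v) ≡ 1) ⇔ (modℕ p (neg u * neg v) ≡ 1)
  inverse-neg {u} {v} u≤p v≤p = mk⇔
    (λ h → from (isOne⇔ (neg u * neg v)) (~-trans same (to (isOne⇔ (u * v)) h)))
    (λ h → from (isOne⇔ (u * v)) (~-trans (~-sym same) (to (isOne⇔ (neg u * neg v)) h)))
    where
    neg*neg : ∀ x y → (- x) ℤ.* (- y) ≡ x ℤ.* y
    neg*neg = solve-∀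
    same : + (neg u * neg v) ~ + (u * v)
    same = begin
      + (neg u * neg v)        ≡⟨ ℤP.pos-* (neg u) (neg v) ⟩
      + neg u ℤ.* + neg v      ≈⟨ ~-* (neg-~ u≤p) (neg-~ v≤p) ⟩
      (- + u) ℤ.* (- + v)      ≡⟨ neg*neg (+ u) (+ v) ⟩
      + u ℤ.* + v              ≡⟨ ℤP.pos-* u v ⟨
      + (u * v)                ∎
      where open ~-Reasoning

  trace-neg : ∀ {j u v} → j < p → u ≤ p → v ≤ p →
    (modℤ p (a ℤ.* + u ℤ.+ b ℤ.* + v) ≡ j) ⇔ (modℤ p (a ℤ.* + neg u ℤ.+ b ℤ.* + neg v) ≡ neg j)
  trace-neg {j} {u} {v} j<p u≤p v≤p = mk⇔
    (λ h → from (modℤ≡⇔~ t′ (neg j) (neg<p j))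
             (~-trans negated (~-trans (~-neg (to (modℤ≡⇔~ t j j<p) h)) (~-sym (neg-~ j≤p)))))
    (λ h → from (modℤ≡⇔~ t j j<p)
             (~-neg⁻¹ (~-trans (~-sym negated) (~-trans (to (modℤ≡⇔~ t′ (neg j) (neg<p j)) h) (neg-~ j≤p)))))
    where
    j≤p = ℕP.<⇒≤ j<p
    t  = a ℤ.* + u ℤ.+ b ℤ.* + v
    t′ = a ℤ.* + neg u ℤ.+ b ℤ.* + neg v
    linear : ∀ a b u v → a ℤ.* (- u) ℤ.+ b ℤ.* (- v) ≡ - (a ℤ.* u ℤ.+ b ℤ.* v)
    linear = solve-∀
    negated : t′ ~ - t
    negated = ~-trans (~-+ (~-* (~-refl {a}) (neg-~ u≤p)) (~-* (~-refl {b}) (neg-~ v≤p)))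
                      (~-reflexive (linear a b (+ u) (+ v)))

  power-split : ∀ {u} → u ≤ p →
    (modℕ p (u ^ (d * 2)) ≡ 1) ⇔ (modℕ p (u ^ d) ≡ 1 ⊎ modℕ p (neg u ^ d) ≡ 1)
  power-split {u} u≤p = mk⇔
    (λ h → [ inj₁ ∘ from (isOne⇔ (u ^ d)) , inj₂ ∘ negOne→ ]′
             (sqrt-one p-prime x (~-trans (~-reflexive (sym square)) (to (isOne⇔ (u ^ (d * 2))) h))))
    (λ h → from (isOne⇔ (u ^ (d * 2))) (~-trans (~-reflexive square) (squareOne h)))
    where
    x = + (u ^ d)
    square : + (u ^ (d * 2)) ≡ x ℤ.* x
    square = trans (cong +_ (trans (sym (ℕP.^-*-assoc u d 2)) (cong (u ^ d *_) (ℕP.*-identityʳ (u ^ d)))))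
                   (ℤP.pos-* (u ^ d) (u ^ d))
    negOne→ : x ~ - + 1 → modℕ p (neg u ^ d) ≡ 1
    negOne→ h = from (isOne⇔ (neg u ^ d)) (~-trans (neg-^-odd-~ m u≤p) (~-neg h))
    →negOne : modℕ p (neg u ^ d) ≡ 1 → x ~ - + 1
    →negOne h = ~-neg⁻¹ (~-trans (~-sym (neg-^-odd-~ m u≤p)) (to (isOne⇔ (neg u ^ d)) h))
    squareOne : modℕ p (u ^ d) ≡ 1 ⊎ modℕ p (neg u ^ d) ≡ 1 → x ℤ.* x ~ + 1
    squareOne (inj₁ h) = ~-* (to (isOne⇔ (u ^ d)) h) (to (isOne⇔ (u ^ d)) h)
    squareOne (inj₂ h) = ~-* (→negOne h) (→negOne h)

  power-exclusive : ∀ {u} → u ≤ p → modℕ p (u ^ d) ≡ 1 → ¬ (modℕ p (neg u ^ d) ≡ 1)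
  power-exclusive {u} u≤p h h′ = one≁minus-one 2≤q (~-trans (~-sym (to (isOne⇔ (u ^ d)) h))
    (~-neg⁻¹ (~-trans (~-sym (neg-^-odd-~ m u≤p)) (to (isOne⇔ (neg u ^ d)) h′))))

  negated-counted : ∀ {j u v} → j < p → u < p → v < p →
    Counted (d * 2) j u v → modℕ p (neg u ^ d) ≡ 1 → Counted d (neg j) (neg u) (neg v)
  negated-counted j<p u<p v<p (u≥1 , unit , _ , tr) pow′ =
    neg-nonzero u≥1 u<p , to (inverse-neg u≤p v≤p) unit , pow′ , to (trace-neg j<p u≤p v≤p) tr
    where
    u≤p = ℕP.<⇒≤ u<p
    v≤p = ℕP.<⇒≤ v<p

  negated-counted⁻¹ : ∀ {j u v} → j < p → u < p → v < p →
    Counted d (neg j) (neg u) (neg v) → Counted (d * 2) j u v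
  negated-counted⁻¹ {j} {u} {v} j<p u<p v<p (u≥1 , unit , pow , tr) =
    neg-nonzero⁻¹ u u≥1 , from (inverse-neg u≤p v≤p) unit ,
    from (power-split {u} u≤p) (inj₂ pow) , from (trace-neg j<p u≤p v≤p) tr
    where
    u≤p = ℕP.<⇒≤ u<p
    v≤p = ℕP.<⇒≤ v<p

  counted-split : ∀ {j u v} → j < p → u < p → v < p →
    Counted (d * 2) j u v → Counted d j u v ⊎ Counted d (neg j) (neg u) (neg v)
  counted-split {j} {u} {v} j<p u<p v<p c@(u≥1 , unit , pow , tr) =
    [ inj₁ ∘ unchanged , inj₂ ∘ negated-counted j<p u<p v<p c ]′ (to (power-split (ℕP.<⇒≤ u<p)) pow)
    where
    unchanged : modℕ p (u ^ d) ≡ 1 → Counted d j u v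
    unchanged pow′ = u≥1 , unit , pow′ , tr

  counted-join : ∀ {j u v} → j < p → u < p → v < p →
    Counted d j u v ⊎ Counted d (neg j) (neg u) (neg v) → Counted (d * 2) j u v
  counted-join {j} {u} {v} j<p u<p v<p (inj₁ (u≥1 , unit , pow , tr)) =
    u≥1 , unit , from (power-split {u} (ℕP.<⇒≤ u<p)) (inj₁ pow) , tr
  counted-join j<p u<p v<p (inj₂ c) = negated-counted⁻¹ j<p u<p v<p c

  counted-exclusive : ∀ {j u v} → u < p → Counted d j u v → ¬ Counted d (neg j) (neg u) (neg v)
  counted-exclusive u<p (_ , _ , pow , _) (_ , _ , pow′ , _) = power-exclusive (ℕP.<⇒≤ u<p) pow pow′

  count-split : ∀ {j u v} → j < p → u < p → v < p →
    count (d * 2) j u v ≡ count d j u v + count d (neg j) (neg u) (neg v)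
  count-split {j} {u} {v} j<p u<p v<p =
    𝟙-split (counted? (d * 2) j u v) (counted? d j u v) (counted? d (neg j) (neg u) (neg v))
      (counted-split j<p u<p v<p) (counted-join j<p u<p v<p) (counted-exclusive u<p)

  coefficient : ℕ → ℕ → ℕ
  coefficient k j = ∑ p (λ u → ∑ p (λ v → count k j u v))

  K≡coefficient : ∀ k j → K a b p k j ≡ + coefficient k j
  K≡coefficient k j = cong +_ (trans (sum-applyUpTo p (λ x → x) _)
    (∑-cong p (λ u _ → sum-applyUpTo p (λ x → x) (count k j u))))

  coefficient-split : ∀ j → j < p → coefficient (d * 2) j ≡ coefficient d j + coefficient d (neg j)
  coefficient-split j j<p = begin
      ∑ p (λ u → ∑ p (λ v → count (d * 2) j u v))
    ≡⟨ ∑-cong p (λ u u<p → ∑-cong p (λ v v<p → count-split j<p u<p v<p)) ⟩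
      ∑ p (λ u → ∑ p (λ v → count d j u v + count d (neg j) (neg u) (neg v)))
    ≡⟨ ∑-cong p (λ u _ → ∑-+ p (count d j u) (count d (neg j) (neg u) ∘ neg)) ⟩
      ∑ p (λ u → ∑ p (count d j u) + ∑ p (count d (neg j) (neg u) ∘ neg))
    ≡⟨ ∑-+ p (λ u → ∑ p (count d j u)) (λ u → ∑ p (count d (neg j) (neg u) ∘ neg)) ⟩
      coefficient d j + ∑ p (λ u → ∑ p (count d (neg j) (neg u) ∘ neg))
    ≡⟨ cong (_+_ (coefficient d j)) (trans (∑-cong p (λ u _ → sym (∑-neg (count d (neg j) (neg u)))))
         (sym (∑-neg (λ u → ∑ p (count d (neg j) u))))) ⟩
      coefficient d j + coefficient d (neg j)
    ∎
    where open ≡-Reasoning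

  K-double-odd : K a b p (d * 2) ≈[ p ] (K a b p d ⊕ conj p (K a b p d))
  K-double-odd = ℤ.0ℤ , λ j j<p → begin
      K a b p (d * 2) j
    ≡⟨ K≡coefficient (d * 2) j ⟩
      + coefficient (d * 2) j
    ≡⟨ cong +_ (coefficient-split j j<p) ⟩
      + (coefficient d j + coefficient d (neg j))
    ≡⟨ ℤP.pos-+ (coefficient d j) (coefficient d (neg j)) ⟩
      + coefficient d j ℤ.+ + coefficient d (neg j)
    ≡⟨ sym (cong₂ ℤ._+_ (K≡coefficient d j) (K≡coefficient d (neg j))) ⟩
      (K a b p d ⊕ conj p (K a b p d)) j
    ≡⟨ sym (ℤP.+-identityʳ _) ⟩
      (K a b p d ⊕ conj p (K a b p d)) j ℤ.+ ℤ.0ℤ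
    ∎
    where open ≡-Reasoning

odd⇒suc-double : ∀ d → ¬ (2 ∣ d) → ∃ λ m → d ≡ suc (m * 2)
odd⇒suc-double d 2∤d with d ℕD.% 2 | ℕD.m%n<n d 2 | ℕD.m≡m%n+[m/n]*n d 2
... | 0             | _               | eq = ⊥-elim (2∤d (divides (d ℕD./ 2) eq))
... | 1             | _               | eq = d ℕD./ 2 , eq
... | suc (suc _)   | s≤s (s≤s ())    | _

/2^-cancel : ∀ e c → (2 ^ e * c) /2^ e ≡ c
/2^-cancel e c = trans (cong (λ t → (t ℕ./ 2 ^ e) {{ℕP.m^n≢0 2 e}}) (ℕP.*-comm (2 ^ e) c))
                       (ℕD.m*n/n≡m c (2 ^ e) {{ℕP.m^n≢0 2 e}})

lemma5 : (p n d : ℕ) → Prime p → ¬ (2 ∣ p) → ¬ (2 ∣ d) → 1 ≤ n → p ≡ 2 ^ n * d + 1 →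
    (a b : ℤ) →
    K a b p ((p ∸ 1) /2^ (n ∸ 1)) ≈[ p ] (K a b p ((p ∸ 1) /2^ n) ⊕ conj p (K a b p ((p ∸ 1) /2^ n)))
lemma5 0 _ _ p-prime _ _ _ _ _ _ = ⊥-elim (¬prime[0] p-prime)
lemma5 1 _ _ p-prime _ _ _ _ _ _ = ⊥-elim (¬prime[1] p-prime)
lemma5 2 _ _ _ 2∤p _ _ _ _ _   = ⊥-elim (2∤p ∣-refl)
lemma5 (suc q@(suc (suc _))) (suc e) d p-prime _ 2∤d _ p≡ a b with odd⇒suc-double d 2∤d
... | m , refl =
  subst₂ (λ k k′ → K a b (suc q) k ≈[ suc q ] (K a b (suc q) k′ ⊕ conj (suc q) (K a b (suc q) k′)))
    (sym (trans (cong (_/2^ e) q≡halved) (/2^-cancel e (d * 2))))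
    (sym (trans (cong (_/2^ suc e) q≡) (/2^-cancel (suc e) d)))
    (Doubling.K-double-odd q (s≤s (s≤s z≤n)) p-prime a b m)
  where
  q≡ : q ≡ 2 ^ suc e * d
  q≡ = ℕP.suc-injective (trans p≡ (ℕP.+-comm _ 1))
  q≡halved : q ≡ 2 ^ e * (d * 2)
  q≡halved = trans q≡ (regroup (2 ^ e) d)
    where
    regroup : ∀ t d → (2 * t) * d ≡ t * (d * 2)
    regroup = ℕR.solve-∀
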